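{- For any graphs $G$ and $H$ with no isolated vertices, $$\chi_{i}(G\odot H)\in\big\{\chi_{i}(G),\ |V(H)|+\Delta(G),\ |V(H)|+\Delta(G)+1\big\}.$$
   Context: All graphs are finite and simple. An injective $k$-coloring of a graph $G$ is a function $f:V(G)\to\{1,\dots,k\}$ such that no vertex is adjacent to two distinct vertices $u,w$ with $f(u)=f(w)$; $\chi_i(G)$, the injective chromatic number, is the minimum such $k$. $\Delta(G)$ is the maximum degree of $G$. For $V(G)=\{v_1,\dots,v_n\}$, the corona product $G\odot H$ is obtained from the disjoint union of $G$ and $n$ disjoint copies $H_1,\dots,H_n$ of $H$ by joining $v_i$ to every vertex of $H_i$, for each $i\in\{1,\dots,n\}$. -}

module Defs where

open import Data.Nat using (ℕ; zero; suc; _+_; _*_; _<_; _⊔_)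
open import Data.Fin using (Fin; splitAt; remQuot)
open import Data.Bool using (Bool; true; false; _∧_; T)
open import Data.Sum using (_⊎_; inj₁; inj₂)
open import Data.Product using (Σ; _×_; _,_; ∃)
open import Data.Vec using (allFin; countᵇ)
open import Data.Fin using (_≟_)
import Data.Fin as F
open import Relation.Nullary using (¬_; does)
open import Relation.Binary.PropositionalEquality using (_≡_)

record Graph : Set where
  field
    n      : ℕ
    adj    : Fin n → Fin n → Bool
open Graph public

IsSimple : Graph → Set
IsSimple G = (∀ u v → adj G u v ≡ adj G v u) × (∀ v → adj G v v ≡ false)

Adj : (G : Graph) → Fin (n G) → Fin (n G) → Set
Adj G u v = T (adj G u v)

degree : (G : Graph) → Fin (n G) → ℕ
degree G v = countᵇ (adj G v) (allFin (n G))

-- maximum degree Δ(G) (0 for the empty graph)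
maxFin : ∀ {k} → (Fin k → ℕ) → ℕ
maxFin {zero}  f = 0
maxFin {suc k} f = f F.zero ⊔ maxFin (λ i → f (F.suc i))

Δ : Graph → ℕ
Δ G = maxFin (degree G)

NoIsolated : Graph → Set
NoIsolated G = ∀ v → ∃ λ u → Adj G v u

IsInjColoring : (G : Graph) (k : ℕ) → (Fin (n G) → Fin k) → Set
IsInjColoring G k f = ∀ v u w → Adj G v u → Adj G v w → f u ≡ f w → u ≡ w

InjColorable : Graph → ℕ → Set
InjColorable G k = Σ (Fin (n G) → Fin k) (IsInjColoring G k)

IsInjChromNum : Graph → ℕ → Set
IsInjChromNum G k = InjColorable G k × (∀ j → j < k → ¬ InjColorable G j)

-- Corona product G ⊙ H.  Vertex set Fin (n G + n G * n H):
-- the first n G vertices are those of G, a vertex decoding (via remQuot)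
-- to (i , x) is vertex x of the i-th copy H_i of H.
coronaAdj : (G H : Graph) → Fin (n G + n G * n H) → Fin (n G + n G * n H) → Bool
coronaAdj G H a b with splitAt (n G) a | splitAt (n G) b
... | inj₁ u | inj₁ v = adj G u v
... | inj₁ u | inj₂ q with remQuot {n G} (n H) q
...   | (i , _) = does (u ≟ i)
coronaAdj G H a b | inj₂ p | inj₁ v with remQuot {n G} (n H) p
...   | (i , _) = does (i ≟ v)
coronaAdj G H a b | inj₂ p | inj₂ q with remQuot {n G} (n H) p | remQuot {n G} (n H) q
...   | (i , x) | (j , y) = does (i ≟ j) ∧ adj H x y

_⊙_ : Graph → Graph → Graph
G ⊙ H = record { n = n G + n G * n H ; adj = coronaAdj G H }

{-# OPTIONS --safe #-}
-- In G ⊙ H a vertex v of G is adjacent to its deg v neighbours in G and to all of H_v, so an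
-- injective colouring needs |V(H)| + deg v distinct colours there: |V(H)| + Δ(G) ≤ χᵢ(G ⊙ H).
-- Restricting to G gives χᵢ(G) ≤ χᵢ(G ⊙ H). Conversely, an injective colouring f of G with
-- max(χᵢ(G), |V(H)| + Δ(G) + 1) colours extends to G ⊙ H by colouring each H_i injectively with
-- colours avoiding f(i) and the colours of the neighbours of i. Only three values fit these bounds.
module Submission where

open import Defs
open import Data.Nat as ℕ using (ℕ; zero; suc; _+_; _*_; _≤_; _<_; _⊔_; s≤s)
open import Data.Nat.Properties
  using (≤-trans; ≤-antisym; m≤m+n; m≤m⊔n; m≤n⊔m; +-suc; +-comm; +-monoʳ-≤; ⊔-sel; ⊔-identityʳ;
         <⇒≱; ≮⇒≥; ≤∧≢⇒<; n≤0⇒n≡0; module ≤-Reasoning)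
open import Data.Fin using (Fin; zero; suc; splitAt; remQuot; combine; join; _↑ʳ_; inject≤; _≟_)
open import Data.Fin.Properties
  using (¬Fin0; injective⇒≤; ¬∀⟶∃¬; splitAt-↑ˡ; splitAt-↑ʳ; splitAt⁻¹-↑ˡ; splitAt⁻¹-↑ʳ; join-splitAt;
         remQuot-combine; combine-remQuot; inject≤-injective)
open import Data.Bool using (Bool; T; _∧_)
open import Data.Bool.Properties using (T-∧)
open import Data.List as List using (List; _∷_; length; lookup; filterᵇ; allFin)
open import Data.List.Properties using (length-map)
open import Data.List.Membership.Propositional using (_∈_; _∉_)
open import Data.List.Membership.Propositional.Properties using (∈-lookup; ∈-allFin; ∈-map⁺; ∈-filter⁺; ∈-filter⁻)
open import Data.List.Relation.Unary.All as All using ()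
open import Data.List.Relation.Unary.Any as Any using (here; there)
open import Data.List.Relation.Unary.Any.Properties using (lookup-index)
open import Data.List.Relation.Unary.Unique.Propositional using (Unique; _∷_)
open import Data.List.Relation.Unary.Unique.Propositional.Properties as Unique using (allFin⁺)
open import Data.Vec as Vec using (countᵇ)
open import Data.Product using (Σ; ∃; _×_; _,_; proj₁; proj₂; uncurry)
open import Data.Sum as Sum using (_⊎_; inj₁; inj₂)
open import Data.Sum.Properties using (inj₁-injective; inj₂-injective)
open import Function using (_∘_; id; Injective)
open import Function.Bundles using (Equivalence)
open import Relation.Nullary using (¬_; Dec; yes; no; does; contradiction)
open import Relation.Nullary.Decidable using (T?)
open import Relation.Binary.PropositionalEquality using (_≡_; refl; sym; trans; cong; cong₂; subst)

Fin? : ∀ k → Dec (Fin k)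
Fin? zero    = no ¬Fin0
Fin? (suc k) = yes zero

≟-sound : ∀ {m} (i j : Fin m) → T (does (i ≟ j)) → i ≡ j
≟-sound i j t with i ≟ j
... | yes i≡j = i≡j

≟-complete : ∀ {m} (i : Fin m) → T (does (i ≟ i))
≟-complete i with i ≟ i
... | yes _   = _
... | no i≢i = i≢i refl

splitAt-injective : ∀ m {k} → Injective _≡_ _≡_ (splitAt m {k})
splitAt-injective m {k} {i} {j} e =
  trans (sym (join-splitAt m k i)) (trans (cong (join m k) e) (join-splitAt m k j))

⊎-map-injective : ∀ {A B C D : Set} {f : A → C} {g : B → D} →
  Injective _≡_ _≡_ f → Injective _≡_ _≡_ g → Injective _≡_ _≡_ (Sum.map f g)
⊎-map-injective f-inj g-inj {inj₁ _} {inj₁ _} e = cong inj₁ (f-inj (inj₁-injective e))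
⊎-map-injective f-inj g-inj {inj₂ _} {inj₂ _} e = cong inj₂ (g-inj (inj₂-injective e))

lookup-injective : ∀ {A : Set} {xs : List A} → Unique xs → Injective _≡_ _≡_ (lookup xs)
lookup-injective {xs = _ ∷ _} (_ ∷ _)      {zero}  {zero}  _ = refl
lookup-injective {xs = _ ∷ _} (x≢xs ∷ _)   {zero}  {suc j} e = contradiction e (All.lookup x≢xs (∈-lookup j))
lookup-injective {xs = _ ∷ _} (x≢xs ∷ _)   {suc i} {zero}  e = contradiction (sym e) (All.lookup x≢xs (∈-lookup i))
lookup-injective {xs = _ ∷ _} (_ ∷ unique) {suc i} {suc j} e = cong suc (lookup-injective unique e)

fresh : ∀ {K} (L : List (Fin K)) → length L < K → ∃ λ c → c ∉ L
-- If every colour occurred in L, its position in L would give an injection Fin K → Fin (length L).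
fresh {K} L L<K = ¬∀⟶∃¬ K (_∈ L) (λ c → Any.any? (c ≟_) L) λ all∈L →
  <⇒≱ L<K (injective⇒≤ λ {c} {d} e →
    trans (lookup-index (all∈L c)) (trans (cong (lookup L) e) (sym (lookup-index (all∈L d)))))

fresh-injection : ∀ {K} m (L : List (Fin K)) → length L + m ≤ K →
  Σ (Fin m → Fin K) λ h → Injective _≡_ _≡_ h × (∀ x → h x ∉ L)
fresh-injection zero    L _ = (λ ()) , (λ { {()} }) , (λ ())
fresh-injection {K} (suc m) L L+1+m≤K = extend (fresh L (≤-trans (m≤m+n _ m) 1+L+m≤K))
  where
  1+L+m≤K : suc (length L) + m ≤ K
  1+L+m≤K = subst (_≤ K) (+-suc (length L) m) L+1+m≤K

  extend : (∃ λ c → c ∉ L) → Σ (Fin (suc m) → Fin K) λ h → Injective _≡_ _≡_ h × (∀ x → h x ∉ L)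
  extend (c , c∉L) with h , h-inj , h∉ ← fresh-injection m (c ∷ L) 1+L+m≤K = h′ , h′-inj , h′∉
    where
    h′ : Fin (suc m) → Fin K
    h′ zero    = c
    h′ (suc x) = h x

    h′-inj : Injective _≡_ _≡_ h′
    h′-inj {zero}  {zero}  _ = refl
    h′-inj {zero}  {suc y} e = contradiction (here (sym e)) (h∉ y)
    h′-inj {suc x} {zero}  e = contradiction (here e) (h∉ x)
    h′-inj {suc x} {suc y} e = cong suc (h-inj e)

    h′∉ : ∀ x → h′ x ∉ L
    h′∉ zero    = c∉L
    h′∉ (suc x) = h∉ x ∘ there

maxFin-attained : ∀ {k} (f : Fin k → ℕ) → Fin k → ∃ λ v → f v ≡ maxFin f
maxFin-attained {suc zero}    f _ = zero , sym (⊔-identityʳ (f zero))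
maxFin-attained {suc (suc k)} f _
  with maxFin-attained (f ∘ suc) zero | ⊔-sel (f zero) (maxFin (f ∘ suc))
... | _ , _    | inj₁ max≡f0   = zero , sym max≡f0
... | v , fv≡m | inj₂ max≡rest = suc v , trans fv≡m (sym max≡rest)

≤-maxFin : ∀ {k} (f : Fin k → ℕ) v → f v ≤ maxFin f
≤-maxFin f zero    = m≤m⊔n _ _
≤-maxFin f (suc v) = ≤-trans (≤-maxFin (f ∘ suc) v) (m≤n⊔m (f zero) _)

neighbours : (G : Graph) → Fin (n G) → List (Fin (n G))
neighbours G v = filterᵇ (adj G v) (allFin (n G))

length-filterᵇ-tabulate : ∀ {A : Set} {m} (p : A → Bool) (f : Fin m → A) →
  length (filterᵇ p (List.tabulate f)) ≡ countᵇ p (Vec.tabulate f)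
length-filterᵇ-tabulate {m = zero}  p f = refl
length-filterᵇ-tabulate {m = suc m} p f with p (f zero)
... | Bool.true  = cong suc (length-filterᵇ-tabulate p (f ∘ suc))
... | Bool.false = length-filterᵇ-tabulate p (f ∘ suc)

length-neighbours : ∀ G v → length (neighbours G v) ≡ degree G v
length-neighbours G v = length-filterᵇ-tabulate (adj G v) id

neighbours-unique : ∀ G v → Unique (neighbours G v)
neighbours-unique G v = Unique.filter⁺ (T? ∘ adj G v) (allFin⁺ (n G))

∈-neighbours⁺ : ∀ {G v u} → Adj G v u → u ∈ neighbours G v
∈-neighbours⁺ {G} {v} {u} = ∈-filter⁺ (T? ∘ adj G v) (∈-allFin u)

∈-neighbours⁻ : ∀ {G v u} → u ∈ neighbours G v → Adj G v u
∈-neighbours⁻ {G} {v} = proj₂ ∘ ∈-filter⁻ (T? ∘ adj G v) {xs = allFin (n G)}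

InjColorable-mono : ∀ {G a K} → a ≤ K → InjColorable G a → InjColorable G K
InjColorable-mono a≤K (f , f-inj) =
  (λ v → inject≤ (f v) a≤K) , λ v u w vu vw e → f-inj v u w vu vw (inject≤-injective a≤K a≤K _ _ e)

InjColorable-empty : ∀ {G} → ¬ Fin (n G) → InjColorable G 0
InjColorable-empty ¬v = (λ v → contradiction v ¬v) , (λ v → contradiction v ¬v)

IsInjChromNum-≤ : ∀ {G c k} → IsInjChromNum G c → InjColorable G k → c ≤ k
IsInjChromNum-≤ {k = k} (_ , minimal) col = ≮⇒≥ λ k<c → minimal k k<c col

IsInjChromNum-empty : ∀ {G c} → IsInjChromNum G c → ¬ Fin (n G) → c ≡ 0
IsInjChromNum-empty χ ¬v = n≤0⇒n≡0 (IsInjChromNum-≤ χ (InjColorable-empty ¬v))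

IsInjColoring-pullback : ∀ {G G′ k f} (φ : Fin (n G) → Fin (n G′)) → Injective _≡_ _≡_ φ →
  (∀ {u v} → Adj G u v → Adj G′ (φ u) (φ v)) → IsInjColoring G′ k f → IsInjColoring G k (f ∘ φ)
IsInjColoring-pullback φ φ-inj φ-adj f-inj v u w vu vw e =
  φ-inj (f-inj (φ v) (φ u) (φ w) (φ-adj vu) (φ-adj vw) e)

neighbourhood-≤ : ∀ {G k f m} → IsInjColoring G k f → (v : Fin (n G)) (g : Fin m → Fin (n G)) →
  Injective _≡_ _≡_ g → (∀ i → Adj G v (g i)) → m ≤ k
neighbourhood-≤ f-inj v g g-inj g-adj = injective⇒≤ λ e → g-inj (f-inj v _ _ (g-adj _) (g-adj _) e)

three-values : ∀ {a c m} → a ≤ c → m ≤ c → c ≤ a ⊔ suc m → c ≡ a ⊎ c ≡ m ⊎ c ≡ m + 1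
three-values {a} {c} {m} a≤c m≤c c≤K with c ℕ.≟ a | c ℕ.≟ m
... | yes c≡a | _       = inj₁ c≡a
... | no _    | yes c≡m = inj₂ (inj₁ c≡m)
... | no c≢a  | no c≢m  = inj₂ (inj₂ (trans (≤-antisym c≤1+m (≤∧≢⇒< m≤c (c≢m ∘ sym))) (+-comm 1 m)))
  where
  c≤1+m : c ≤ suc m
  c≤1+m with ⊔-sel a (suc m)
  ... | inj₁ K≡a   = contradiction (≤-antisym (subst (c ≤_) K≡a c≤K) a≤c) c≢a
  ... | inj₂ K≡1+m = subst (c ≤_) K≡1+m c≤K

module Corona (G H : Graph) where

  Vertex : Set
  Vertex = Fin (n G) ⊎ (Fin (n G) × Fin (n H))

  decode : Fin (n (G ⊙ H)) → Vertex
  decode a = Sum.map₂ (remQuot (n H)) (splitAt (n G) a)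

  encode : Vertex → Fin (n (G ⊙ H))
  encode v = join (n G) (n G * n H) (Sum.map₂ (uncurry combine) v)

  decode-encode : ∀ v → decode (encode v) ≡ v
  decode-encode (inj₁ u) rewrite splitAt-↑ˡ (n G) u (n G * n H) = refl
  decode-encode (inj₂ (i , x))
    rewrite splitAt-↑ʳ (n G) (n G * n H) (combine i x) = cong inj₂ (remQuot-combine i x)

  encode-decode : ∀ a → encode (decode a) ≡ a
  encode-decode a with splitAt (n G) a in eq
  ... | inj₁ u = splitAt⁻¹-↑ˡ eq
  ... | inj₂ p = trans (cong (n G ↑ʳ_) (combine-remQuot {n G} (n H) p)) (splitAt⁻¹-↑ʳ eq)

  encode-injective : Injective _≡_ _≡_ encode
  encode-injective {v} {w} e = trans (sym (decode-encode v)) (trans (cong decode e) (decode-encode w))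

  decode-injective : Injective _≡_ _≡_ decode
  decode-injective {a} {b} e = trans (sym (encode-decode a)) (trans (cong encode e) (encode-decode b))

  adjacent : Vertex → Vertex → Bool
  adjacent (inj₁ u)       (inj₁ w)       = adj G u w
  adjacent (inj₁ u)       (inj₂ (i , _)) = does (u ≟ i)
  adjacent (inj₂ (i , _)) (inj₁ w)       = does (i ≟ w)
  adjacent (inj₂ (i , x)) (inj₂ (j , y)) = does (i ≟ j) ∧ adj H x y

  coronaAdj-decode : ∀ a b → coronaAdj G H a b ≡ adjacent (decode a) (decode b)
  coronaAdj-decode a b with splitAt (n G) a | splitAt (n G) b
  ... | inj₁ u | inj₁ v = refl
  ... | inj₁ u | inj₂ q with remQuot {n G} (n H) q
  ...   | _ = refl
  coronaAdj-decode a b | inj₂ p | inj₁ v with remQuot {n G} (n H) p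
  ...   | _ = refl
  coronaAdj-decode a b | inj₂ p | inj₂ q with remQuot {n G} (n H) p | remQuot {n G} (n H) q
  ...   | _ | _ = refl

  Adj-encode : ∀ v w → T (adjacent v w) → Adj (G ⊙ H) (encode v) (encode w)
  Adj-encode v w = subst T (sym (trans (coronaAdj-decode (encode v) (encode w))
                                     (cong₂ adjacent (decode-encode v) (decode-encode w))))

  IsInjColoringᵛ : (k : ℕ) → (Vertex → Fin k) → Set
  IsInjColoringᵛ k h = ∀ v u w → T (adjacent v u) → T (adjacent v w) → h u ≡ h w → u ≡ w

  decode-coloring : ∀ {k h} → IsInjColoringᵛ k h → IsInjColoring (G ⊙ H) k (h ∘ decode)
  decode-coloring h-inj v u w vu vw e = decode-injective (h-inj (decode v) (decode u) (decode w)
    (subst T (coronaAdj-decode v u) vu) (subst T (coronaAdj-decode v w) vw) e)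

  restrict : ∀ {k} → InjColorable (G ⊙ H) k → InjColorable G k
  restrict (f , f-inj) = f ∘ encode ∘ inj₁ ,
    IsInjColoring-pullback (encode ∘ inj₁) (inj₁-injective ∘ encode-injective)
                           (Adj-encode (inj₁ _) (inj₁ _)) f-inj

  star : (v : Fin (n G)) → Fin (length (neighbours G v)) ⊎ Fin (n H) → Vertex
  star v = Sum.map (lookup (neighbours G v)) (v ,_)

  star-injective : ∀ v → Injective _≡_ _≡_ (star v)
  star-injective v = ⊎-map-injective (lookup-injective (neighbours-unique G v)) (cong proj₂)

  star-adjacent : ∀ v s → T (adjacent (inj₁ v) (star v s))
  star-adjacent v (inj₁ j) = ∈-neighbours⁻ {G} (∈-lookup j)
  star-adjacent v (inj₂ x) = ≟-complete v

  size+degree≤ : ∀ {k} → InjColorable (G ⊙ H) k → ∀ v → n H + degree G v ≤ k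
  size+degree≤ {k} (f , f-inj) v =
    subst (_≤ k) (trans (cong (_+ n H) (length-neighbours G v)) (+-comm _ (n H)))
    (neighbourhood-≤ f-inj (encode (inj₁ v)) (encode ∘ star v ∘ splitAt _)
      (splitAt-injective _ ∘ star-injective v ∘ encode-injective)
      (λ i → Adj-encode (inj₁ v) (star v (splitAt _ i)) (star-adjacent v (splitAt _ i))))

  module Extension {K} (f : Fin (n G) → Fin K) (f-inj : IsInjColoring G K f) (room : n H + Δ G < K) where

    forbidden : Fin (n G) → List (Fin K)
    forbidden i = f i ∷ List.map f (neighbours G i)

    length-forbidden : ∀ i → length (forbidden i) + n H ≤ K
    length-forbidden i = begin
      suc (length (List.map f (neighbours G i))) + n H
        ≡⟨ cong (λ d → suc d + n H) (trans (length-map f (neighbours G i)) (length-neighbours G i)) ⟩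
      suc (degree G i + n H)  ≡⟨ cong suc (+-comm (degree G i) (n H)) ⟩
      suc (n H + degree G i)  ≤⟨ s≤s (+-monoʳ-≤ (n H) (≤-maxFin (degree G) i)) ⟩
      suc (n H + Δ G)         ≤⟨ room ⟩
      K                       ∎
      where open ≤-Reasoning

    ∈-forbidden : ∀ {i u} → Adj G i u → f u ∈ forbidden i
    ∈-forbidden iu = there (∈-map⁺ f (∈-neighbours⁺ {G} iu))

    palette : Fin (n G) → Fin (n H) → Fin K
    palette i = proj₁ (fresh-injection (n H) (forbidden i) (length-forbidden i))

    palette-injective : ∀ i → Injective _≡_ _≡_ (palette i)
    palette-injective i = proj₁ (proj₂ (fresh-injection (n H) (forbidden i) (length-forbidden i)))

    palette-fresh : ∀ i x → palette i x ∉ forbidden i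
    palette-fresh i = proj₂ (proj₂ (fresh-injection (n H) (forbidden i) (length-forbidden i)))

    colour : Vertex → Fin K
    colour (inj₁ u)       = f u
    colour (inj₂ (i , x)) = palette i x

    same-copy : ∀ i x j y → T (adjacent (inj₂ (i , x)) (inj₂ (j , y))) → i ≡ j
    same-copy i x j y = ≟-sound i j ∘ proj₁ ∘ Equivalence.to T-∧

    colour-injective : IsInjColoringᵛ K colour
    colour-injective (inj₁ i) (inj₁ u) (inj₁ w) iu iw e = cong inj₁ (f-inj i u w iu iw e)
    colour-injective (inj₁ i) (inj₁ u) (inj₂ (j , y)) iu ij e with refl ← ≟-sound i j ij =
      contradiction (subst (_∈ forbidden i) e (∈-forbidden iu)) (palette-fresh i y)
    colour-injective (inj₁ i) (inj₂ (j , x)) (inj₁ w) ij iw e with refl ← ≟-sound i j ij =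
      contradiction (subst (_∈ forbidden i) (sym e) (∈-forbidden iw)) (palette-fresh i x)
    colour-injective (inj₁ i) (inj₂ (j , x)) (inj₂ (j′ , y)) ij ij′ e
      with refl ← ≟-sound i j ij | refl ← ≟-sound i j′ ij′ =
      cong (inj₂ ∘ (i ,_)) (palette-injective i e)
    colour-injective (inj₂ (i , x)) (inj₁ u) (inj₁ w) iu iw e
      with refl ← ≟-sound i u iu | refl ← ≟-sound i w iw = refl
    colour-injective (inj₂ (i , x)) (inj₁ u) (inj₂ (j , y)) iu ij e
      with refl ← ≟-sound i u iu | refl ← same-copy i x j y ij =
      contradiction (subst (_∈ forbidden i) e (here refl)) (palette-fresh i y)
    colour-injective (inj₂ (i , x)) (inj₂ (j , y)) (inj₁ w) ij iw e
      with refl ← ≟-sound i w iw | refl ← same-copy i x j y ij =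
      contradiction (subst (_∈ forbidden i) (sym e) (here refl)) (palette-fresh i y)
    colour-injective (inj₂ (i , x)) (inj₂ (j , y)) (inj₂ (j′ , z)) ij ij′ e
      with refl ← same-copy i x j y ij | refl ← same-copy i x j′ z ij′ =
      cong (inj₂ ∘ (i ,_)) (palette-injective i e)

  corona-colorable : ∀ {K} → InjColorable G K → n H + Δ G < K → InjColorable (G ⊙ H) K
  corona-colorable (f , f-inj) room = colour ∘ decode , decode-coloring colour-injective
    where open Extension f f-inj room

theorem3p2 : (G H : Graph) → IsSimple G → IsSimple H → NoIsolated G → NoIsolated H →
    (a c : ℕ) → IsInjChromNum G a → IsInjChromNum (G ⊙ H) c →
    c ≡ a ⊎ c ≡ n H + Δ G ⊎ c ≡ n H + Δ G + 1
theorem3p2 G H _ _ _ _ a c χG χG⊙H with Fin? (n G)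
... | no ¬v = inj₁ (trans (IsInjChromNum-empty χG⊙H (¬v ∘ Sum.[ id , proj₁ ] ∘ decode))
                          (sym (IsInjChromNum-empty χG ¬v)))
  where open Corona G H
... | yes v = three-values a≤c m≤c c≤K
  where
  open Corona G H
  a≤c : a ≤ c
  a≤c = IsInjChromNum-≤ χG (restrict (proj₁ χG⊙H))

  m≤c : n H + Δ G ≤ c
  m≤c with vmax , deg≡Δ ← maxFin-attained (degree G) v =
    subst (λ d → n H + d ≤ c) deg≡Δ (size+degree≤ (proj₁ χG⊙H) vmax)

  c≤K : c ≤ a ⊔ suc (n H + Δ G)
  c≤K = IsInjChromNum-≤ χG⊙H
          (corona-colorable (InjColorable-mono (m≤m⊔n a _) (proj₁ χG)) (m≤n⊔m a _))
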